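{- Let $G$ be a connected graph of order $n_1\ge 2$ and let $H$ be a graph of order $n_2\ge 2$. Then for every integer $k\ge1$, $$Z(G\odot^{k}H)\le n_1(n_2+1)^{k-1}Z(K_1\odot H).$$
   Context: Graphs are finite, simple, undirected. Zero forcing: given a set $S$ of initially black vertices (others white), the color-change rule turns a white vertex black if it is the only white neighbor of some black vertex; $S$ is a zero forcing set if eventually all vertices become black; $Z(G)$ is the minimum size of a zero forcing set. Corona product: for $G$ of order $n_1$, $G\odot H$ is obtained from one copy of $G$ and $n_1$ disjoint copies of $H$ by joining the $i$-th vertex of $G$ to every vertex of the $i$-th copy of $H$; $G\odot^1H=G\odot H$ and $G\odot^kH=(G\odot^{k-1}H)\odot H$ for $k\ge2$. $K_1\odot H$ is the join of a single vertex with $H$. -}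

module Defs where

open import Data.Nat using (ℕ; zero; suc; _+_; _*_; _≤_)
open import Data.Bool using (Bool; true; false; _∧_)
open import Data.Bool.Properties using (∧-comm; ∧-zeroʳ)
open import Data.Fin using (Fin; splitAt; quotient; remainder; _≟_; zero)
open import Data.Fin.Subset using (Subset; _∈_; ∣_∣)
open import Data.Empty using (⊥-elim)
open import Data.Sum using (_⊎_; inj₁; inj₂)
open import Data.Product using (Σ; _×_; _,_)
open import Relation.Nullary using (¬_; yes; no)
open import Relation.Nullary.Decidable using (⌊_⌋)
open import Relation.Binary.PropositionalEquality using (_≡_; refl; sym; cong₂)

record Graph : Set where
  field
    order  : ℕ
    adj    : Fin order → Fin order → Bool
    adj-sym    : ∀ u v → adj u v ≡ adj v u
    adj-irrefl : ∀ u → adj u u ≡ false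
open Graph public

eqᵇ : ∀ {n} → Fin n → Fin n → Bool
eqᵇ i j = ⌊ i ≟ j ⌋

eqᵇ-sym : ∀ {n} (i j : Fin n) → eqᵇ i j ≡ eqᵇ j i
eqᵇ-sym i j with i ≟ j | j ≟ i
... | yes _   | yes _ = refl
... | no _    | no _  = refl
... | yes i≡j | no j≢i = ⊥-elim (j≢i (sym i≡j))
... | no i≢j  | yes j≡i = ⊥-elim (i≢j (sym j≡i))

K₁ : Graph
K₁ = record { order = 1 ; adj = λ _ _ → false ; adj-sym = λ _ _ → refl ; adj-irrefl = λ _ → refl }

-- Corona product G ⊙ H.  Vertex set Fin (n₁ + n₁ * n₂): the first n₁
-- vertices are the copy of G; a vertex p of the second block with
-- remQuot p = (i , a) is vertex a of the i-th copy of H.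
module _ (G H : Graph) where
  private
    n₁ = order G
    n₂ = order H
    V  = Fin n₁ ⊎ Fin (n₁ * n₂)

  coronaAdj⊎ : V → V → Bool
  coronaAdj⊎ (inj₁ i) (inj₁ j) = adj G i j
  coronaAdj⊎ (inj₁ i) (inj₂ q) = eqᵇ i (quotient {n₁} n₂ q)
  coronaAdj⊎ (inj₂ p) (inj₁ j) = eqᵇ (quotient {n₁} n₂ p) j
  coronaAdj⊎ (inj₂ p) (inj₂ q) =
    eqᵇ (quotient {n₁} n₂ p) (quotient {n₁} n₂ q) ∧ adj H (remainder {n₁} n₂ p) (remainder {n₁} n₂ q)

  coronaAdj⊎-sym : ∀ x y → coronaAdj⊎ x y ≡ coronaAdj⊎ y x
  coronaAdj⊎-sym (inj₁ i) (inj₁ j) = Graph.adj-sym G i j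
  coronaAdj⊎-sym (inj₁ i) (inj₂ q) = eqᵇ-sym i (quotient {n₁} n₂ q)
  coronaAdj⊎-sym (inj₂ p) (inj₁ j) = eqᵇ-sym (quotient {n₁} n₂ p) j
  coronaAdj⊎-sym (inj₂ p) (inj₂ q) =
    cong₂ _∧_ (eqᵇ-sym (quotient {n₁} n₂ p) (quotient {n₁} n₂ q))
              (Graph.adj-sym H (remainder {n₁} n₂ p) (remainder {n₁} n₂ q))

  coronaAdj⊎-irrefl : ∀ x → coronaAdj⊎ x x ≡ false
  coronaAdj⊎-irrefl (inj₁ i) = Graph.adj-irrefl G i
  coronaAdj⊎-irrefl (inj₂ p) rewrite Graph.adj-irrefl H (remainder {n₁} n₂ p) =
    ∧-zeroʳ (eqᵇ (quotient {n₁} n₂ p) (quotient {n₁} n₂ p))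

  _⊙_ : Graph
  _⊙_ = record
    { order  = n₁ + n₁ * n₂
    ; adj    = λ u v → coronaAdj⊎ (splitAt n₁ u) (splitAt n₁ v)
    ; adj-sym    = λ u v → coronaAdj⊎-sym (splitAt n₁ u) (splitAt n₁ v)
    ; adj-irrefl = λ u → coronaAdj⊎-irrefl (splitAt n₁ u)
    }

_⊙^_[_] : Graph → ℕ → Graph → Graph
G ⊙^ zero [ H ] = G
G ⊙^ suc k [ H ] = (G ⊙^ k [ H ]) ⊙ H

data Reach (G : Graph) : Fin (order G) → Fin (order G) → Set where
  here : ∀ {u} → Reach G u u
  step : ∀ {u v w} → adj G u v ≡ true → Reach G v w → Reach G u w

Connected : Graph → Set
Connected G = ∀ u v → Reach G u v

-- Black G S v: v is black at the end of the colour-change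
-- process started from the black set S.  The final black set is the least
-- set containing S and closed under the rule "if u is black and v is the
-- only white neighbour of u, then v becomes black".
data Black (G : Graph) (S : Subset (order G)) : Fin (order G) → Set where
  initial : ∀ {v} → v ∈ S → Black G S v
  force   : ∀ {u v} → Black G S u → adj G u v ≡ true →
            (∀ w → adj G u w ≡ true → ¬ (w ≡ v) → Black G S w) →
            Black G S v

IsZeroForcingSet : (G : Graph) → Subset (order G) → Set
IsZeroForcingSet G S = ∀ v → Black G S v

IsZeroForcingNumber : Graph → ℕ → Set
IsZeroForcingNumber G z =
  (Σ (Subset (order G)) λ S → IsZeroForcingSet G S × ∣ S ∣ ≡ z) ×
  (∀ S → IsZeroForcingSet G S → z ≤ ∣ S ∣)

-- G ⊙ H consists of |G| copies of K₁ ⊙ H glued only along their centres, which span G.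
-- Put a minimum zero forcing set of K₁ ⊙ H into every copy.  A force of K₁ ⊙ H by a
-- non-centre vertex can be replayed in all copies at once; a force by the centre only once
-- all of G is black.  Replaying the forcing process of K₁ ⊙ H, every vertex becomes black
-- in all copies unless the centre already has, and the centre itself is black in K₁ ⊙ H;
-- so all of G turns black, after which the whole process replays.  Hence
-- Z(G ⊙ H) ≤ |G| Z(K₁ ⊙ H), and iterating with |G ⊙^k H| = |G| (|H| + 1)^k gives the bound.
module Submission where

open import Defs
open import Data.Nat using (ℕ; zero; suc; _+_; _*_; _^_; _≤_)
open import Data.Nat.Properties using (*-identityˡ; *-identityʳ; *-assoc; *-comm; *-distribˡ-+; +-comm)
open import Data.Bool using (Bool; true; false; _∧_; T)
open import Data.Bool.Properties using (∧-conicalˡ)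
open import Data.Unit using (tt)
open import Data.Fin using (Fin; zero; suc; splitAt; join; _↑ˡ_; _↑ʳ_; combine; remQuot; quotient; remainder; _≟_)
open import Data.Fin.Properties using (splitAt-↑ˡ; splitAt-↑ʳ; join-splitAt; remQuot-combine; combine-remQuot; ∀-cons)
open import Data.Fin.Subset using (Subset; _∈_; ∣_∣)
open import Data.Vec using ([]; _∷_; _++_; concat; replicate; lookup; group)
open import Data.Vec.Properties using (lookup-++ˡ; lookup-++ʳ; lookup-concat; lookup-replicate; []=⇒lookup; lookup⇒[]=)
open import Data.Sum using (_⊎_; inj₁; inj₂; map₂)
open import Data.Product using (∃; ∃₂; _×_; _,_; proj₁; proj₂; uncurry)
open import Relation.Nullary using (¬_; yes; no; contradiction)
open import Relation.Nullary.Decidable using (isYes≗does; dec-true; toWitness)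
open import Relation.Binary.PropositionalEquality
open import Function using (_∘_)

∀⊎-Fin : ∀ {k} {P : Fin k → Set} {B : Set} → (∀ x → P x ⊎ B) → (∀ x → P x) ⊎ B
∀⊎-Fin {zero}  f = inj₁ λ ()
∀⊎-Fin {suc k} f with f zero | ∀⊎-Fin (λ x → f (suc x))
... | inj₂ b | _       = inj₂ b
... | inj₁ _ | inj₂ b  = inj₂ b
... | inj₁ p | inj₁ ps = inj₁ (∀-cons p ps)

eqᵇ-refl : ∀ {n} (i : Fin n) → eqᵇ i i ≡ true
eqᵇ-refl i = trans (isYes≗does (i ≟ i)) (dec-true (i ≟ i) refl)

eqᵇ⇒≡ : ∀ {n} {i j : Fin n} → eqᵇ i j ≡ true → i ≡ j
eqᵇ⇒≡ e = toWitness (subst T (sym e) tt)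

∣p++q∣ : ∀ {a b} (p : Subset a) (q : Subset b) → ∣ p ++ q ∣ ≡ ∣ p ∣ + ∣ q ∣
∣p++q∣ []          q = refl
∣p++q∣ (true ∷ p)  q = cong suc (∣p++q∣ p q)
∣p++q∣ (false ∷ p) q = ∣p++q∣ p q

∣replicate∣ : ∀ m (b : Bool) → ∣ replicate m b ∣ ≡ m * ∣ b ∷ [] ∣
∣replicate∣ zero    b = refl
∣replicate∣ (suc m) b = trans (∣p++q∣ (b ∷ []) (replicate m b)) (cong (∣ b ∷ [] ∣ +_) (∣replicate∣ m b))

∣concat-replicate∣ : ∀ m {n} (p : Subset n) → ∣ concat (replicate m p) ∣ ≡ m * ∣ p ∣
∣concat-replicate∣ zero    p = refl
∣concat-replicate∣ (suc m) p = trans (∣p++q∣ p _) (cong (∣ p ∣ +_) (∣concat-replicate∣ m p))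

module CopyForcing
  (K X : Graph) {m : ℕ} (c : Fin (order K)) (φ : Fin m → Fin (order K) → Fin (order X))
  (φ-adj : ∀ i u v → adj X (φ i u) (φ i v) ≡ adj K u v)
  (φ-nbr : ∀ i u y → adj X (φ i u) y ≡ true →
             (∃ λ w → y ≡ φ i w) ⊎ (u ≡ c × ∃ λ j → y ≡ φ j c))
  (S : Subset (order K)) (S′ : Subset (order X)) (φ-∈ : ∀ i u → u ∈ S → φ i u ∈ S′)
  where

  BlackInAllCopies : Fin (order K) → Set
  BlackInAllCopies u = ∀ i → Black X S′ (φ i u)

  force-in-copy : ∀ i {u v} → Black X S′ (φ i u) → adj K u v ≡ true →
                  (∀ w → adj K u w ≡ true → ¬ w ≡ v → Black X S′ (φ i w)) →
                  (u ≡ c → BlackInAllCopies c) → Black X S′ (φ i v)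
  force-in-copy i {u} {v} black-u u-v others centre = force black-u (trans (φ-adj i u v) u-v) black-nbr
    where
    black-nbr : ∀ y → adj X (φ i u) y ≡ true → ¬ y ≡ φ i v → Black X S′ y
    black-nbr y u-y y≢v with φ-nbr i u y u-y
    ... | inj₁ (w , refl)        = others w (trans (sym (φ-adj i u w)) u-y) (λ w≡v → y≢v (cong (φ i) w≡v))
    ... | inj₂ (u≡c , j , refl) = centre u≡c j

  black⇒inAllCopies⊎centre : ∀ {u} → Black K S u → BlackInAllCopies u ⊎ BlackInAllCopies c
  black⇒inAllCopies⊎centre (initial u∈S) = inj₁ λ i → initial (φ-∈ i _ u∈S)
  black⇒inAllCopies⊎centre (force {u} {v} black-u u-v others) with black⇒inAllCopies⊎centre black-u
  ... | inj₂ centre  = inj₂ centre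
  ... | inj₁ in-all-u with ∀⊎-Fin others⊎centre
    where
    others⊎centre : ∀ w → (adj K u w ≡ true → ¬ w ≡ v → BlackInAllCopies w) ⊎ BlackInAllCopies c
    others⊎centre w with adj K u w in u-w | w ≟ v
    ... | false | _        = inj₁ λ ()
    ... | true  | yes w≡v  = inj₁ λ _ w≢v → contradiction w≡v w≢v
    ... | true  | no w≢v with black⇒inAllCopies⊎centre (others w u-w w≢v)
    ...   | inj₁ in-all-w = inj₁ λ _ _ → in-all-w
    ...   | inj₂ centre   = inj₂ centre
  ... | inj₂ centre      = inj₂ centre
  ... | inj₁ in-all-nbrs = inj₁ λ i →
    force-in-copy i (in-all-u i) u-v (λ w u-w w≢v → in-all-nbrs w u-w w≢v i) (λ { refl → in-all-u })

  centre⇒black⇒inAllCopies : BlackInAllCopies c → ∀ {u} → Black K S u → BlackInAllCopies u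
  centre⇒black⇒inAllCopies centre (initial u∈S) i = initial (φ-∈ i _ u∈S)
  centre⇒black⇒inAllCopies centre (force black-u u-v others) i =
    force-in-copy i (centre⇒black⇒inAllCopies centre black-u i) u-v
      (λ w u-w w≢v → centre⇒black⇒inAllCopies centre (others w u-w w≢v) i) (λ _ → centre)

  zeroForcing⇒inAllCopies : IsZeroForcingSet K S → ∀ u → BlackInAllCopies u
  zeroForcing⇒inAllCopies zf u = centre⇒black⇒inAllCopies centre (zf u)
    where
    centre : BlackInAllCopies c
    centre with black⇒inAllCopies⊎centre (zf c)
    ... | inj₁ in-all = in-all
    ... | inj₂ in-all = in-all

-- Vertex i of G is inj₁ i, and vertex a of the i-th copy of H is inj₂ (i , a).
Vertex⊙ : ℕ → ℕ → Set
Vertex⊙ m n = Fin m ⊎ (Fin m × Fin n)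

module _ {m n : ℕ} where

  toFin : Vertex⊙ m n → Fin (m + m * n)
  toFin (inj₁ i)       = i ↑ˡ (m * n)
  toFin (inj₂ (i , a)) = m ↑ʳ combine i a

  fromFin : Fin (m + m * n) → Vertex⊙ m n
  fromFin x = map₂ (remQuot n) (splitAt m x)

  fromFin-toFin : ∀ v → fromFin (toFin v) ≡ v
  fromFin-toFin (inj₁ i)       rewrite splitAt-↑ˡ m i (m * n) = refl
  fromFin-toFin (inj₂ (i , a)) rewrite splitAt-↑ʳ m (m * n) (combine i a) | remQuot-combine {m} {n} i a = refl

  toFin-fromFin : ∀ x → toFin (fromFin x) ≡ x
  toFin-fromFin x with splitAt m x in eq
  ... | inj₁ i = trans (cong (join m (m * n)) (sym eq)) (join-splitAt m (m * n) x)
  ... | inj₂ p = trans (cong (m ↑ʳ_) (combine-remQuot {m} n p))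
                       (trans (cong (join m (m * n)) (sym eq)) (join-splitAt m (m * n) x))

  fromFin≡⇒≡toFin : ∀ {x} {v : Vertex⊙ m n} → fromFin x ≡ v → x ≡ toFin v
  fromFin≡⇒≡toFin {x} refl = sym (toFin-fromFin x)

  splitAt-toFin : ∀ v → splitAt m (toFin v) ≡ map₂ (uncurry combine) v
  splitAt-toFin (inj₁ i)       = splitAt-↑ˡ m i (m * n)
  splitAt-toFin (inj₂ (i , a)) = splitAt-↑ʳ m (m * n) (combine i a)

quotient-combine : ∀ {m n} (i : Fin m) (a : Fin n) → quotient {m} n (combine i a) ≡ i
quotient-combine {m} {n} i a = cong proj₁ (remQuot-combine {m} {n} i a)

remainder-combine : ∀ {m n} (i : Fin m) (a : Fin n) → remainder {m} n (combine i a) ≡ a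
remainder-combine {m} {n} i a = cong proj₂ (remQuot-combine {m} {n} i a)

module _ (G H : Graph) where

  adj⊙ : Vertex⊙ (order G) (order H) → Vertex⊙ (order G) (order H) → Bool
  adj⊙ (inj₁ i)       (inj₁ j)       = adj G i j
  adj⊙ (inj₁ i)       (inj₂ (j , b)) = eqᵇ i j
  adj⊙ (inj₂ (i , a)) (inj₁ j)       = eqᵇ i j
  adj⊙ (inj₂ (i , a)) (inj₂ (j , b)) = eqᵇ i j ∧ adj H a b

  adj-toFin : ∀ u v → adj (G ⊙ H) (toFin u) (toFin v) ≡ adj⊙ u v
  adj-toFin u v rewrite splitAt-toFin u | splitAt-toFin v = adj⊎ u v
    where
    adj⊎ : ∀ u v → coronaAdj⊎ G H (map₂ (uncurry combine) u) (map₂ (uncurry combine) v) ≡ adj⊙ u v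
    adj⊎ (inj₁ i)       (inj₁ j)       = refl
    adj⊎ (inj₁ i)       (inj₂ (j , b)) rewrite quotient-combine {order G} {order H} j b = refl
    adj⊎ (inj₂ (i , a)) (inj₁ j)       rewrite quotient-combine {order G} {order H} i a = refl
    adj⊎ (inj₂ (i , a)) (inj₂ (j , b))
      rewrite quotient-combine {order G} {order H} i a | quotient-combine {order G} {order H} j b
            | remainder-combine {order G} {order H} i a | remainder-combine {order G} {order H} j b = refl

  adj-toFin-fromFin : ∀ u y → adj (G ⊙ H) (toFin u) y ≡ adj⊙ u (fromFin y)
  adj-toFin-fromFin u y = trans (cong (adj (G ⊙ H) (toFin u)) (sym (toFin-fromFin {order G} {order H} y))) (adj-toFin u (fromFin y))

inCopy : ∀ {m n} → Fin m → Vertex⊙ 1 n → Vertex⊙ m n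
inCopy i (inj₁ _)       = inj₁ i
inCopy i (inj₂ (_ , a)) = inj₂ (i , a)

module _ (G H : Graph) where

  adj⊙-inCopy : ∀ i a b → adj⊙ G H (inCopy i a) (inCopy i b) ≡ adj⊙ K₁ H a b
  adj⊙-inCopy i (inj₁ zero)       (inj₁ zero)       = adj-irrefl G i
  adj⊙-inCopy i (inj₁ zero)       (inj₂ (zero , b)) = eqᵇ-refl i
  adj⊙-inCopy i (inj₂ (zero , a)) (inj₁ zero)       = eqᵇ-refl i
  adj⊙-inCopy i (inj₂ (zero , a)) (inj₂ (zero , b)) rewrite eqᵇ-refl i = refl

  adj⊙-inCopy-nbr : ∀ i v y → adj⊙ G H (inCopy i v) y ≡ true →
                    (∃ λ w → y ≡ inCopy i w) ⊎ (v ≡ inj₁ zero × ∃ λ j → y ≡ inj₁ j)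
  adj⊙-inCopy-nbr i (inj₁ zero)       (inj₁ j)       _   = inj₂ (refl , j , refl)
  adj⊙-inCopy-nbr i (inj₁ zero)       (inj₂ (j , b)) i-j = inj₁ (inj₂ (zero , b) , cong (λ k → inj₂ (k , b)) (sym (eqᵇ⇒≡ i-j)))
  adj⊙-inCopy-nbr i (inj₂ (zero , a)) (inj₁ j)       i-j = inj₁ (inj₁ zero , cong inj₁ (sym (eqᵇ⇒≡ i-j)))
  adj⊙-inCopy-nbr i (inj₂ (zero , a)) (inj₂ (j , b)) a-b =
    inj₁ (inj₂ (zero , b) , cong (λ k → inj₂ (k , b)) (sym (eqᵇ⇒≡ (∧-conicalˡ (eqᵇ i j) (adj H a b) a-b))))

  inCopy-surjective : ∀ (y : Vertex⊙ (order G) (order H)) → ∃₂ λ i w → y ≡ inCopy i w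
  inCopy-surjective (inj₁ j)       = j , inj₁ zero , refl
  inCopy-surjective (inj₂ (j , a)) = j , inj₂ (zero , a) , refl

-- In the vertex order of G ⊙ H: each vertex of G gets colour c, each copy of H the colouring R.
copies : ∀ m {n} → Bool → Subset n → Subset (m + m * n)
copies m c R = replicate m c ++ concat (replicate m R)

colourOf : ∀ {m n} → Bool → Subset n → Vertex⊙ m n → Bool
colourOf c R (inj₁ _)       = c
colourOf c R (inj₂ (_ , a)) = lookup R a

lookup-copies : ∀ {m n} c (R : Subset n) (v : Vertex⊙ m n) → lookup (copies m c R) (toFin v) ≡ colourOf c R v
lookup-copies {m} {n} c R (inj₁ i) = begin
  lookup (replicate m c ++ concat (replicate m R)) (i ↑ˡ (m * n)) ≡⟨ lookup-++ˡ (replicate m c) _ i ⟩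
  lookup (replicate m c) i                                         ≡⟨ lookup-replicate i c ⟩
  c                                                                ∎
  where open ≡-Reasoning
lookup-copies {m} {n} c R (inj₂ (i , a)) = begin
  lookup (replicate m c ++ concat (replicate m R)) (m ↑ʳ combine i a) ≡⟨ lookup-++ʳ (replicate m c) _ (combine i a) ⟩
  lookup (concat (replicate m R)) (combine i a)                        ≡⟨ lookup-concat (replicate m R) i a ⟩
  lookup (lookup (replicate m R) i) a                                  ≡⟨ cong (λ r → lookup r a) (lookup-replicate i R) ⟩
  lookup R a                                                           ∎
  where open ≡-Reasoning

colourOf-inCopy : ∀ {m n} c (R : Subset n) (i : Fin m) w → colourOf c R (inCopy i w) ≡ colourOf c R w
colourOf-inCopy c R i (inj₁ _) = refl
colourOf-inCopy c R i (inj₂ _) = refl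

∈-copies-inCopy : ∀ {m n} c (R : Subset n) (i : Fin m) w →
                  toFin w ∈ copies 1 c R → toFin (inCopy i w) ∈ copies m c R
∈-copies-inCopy {m} c R i w w∈ = lookup⇒[]= _ (copies m c R) (begin
  lookup (copies m c R) (toFin (inCopy i w)) ≡⟨ lookup-copies c R (inCopy i w) ⟩
  colourOf c R (inCopy i w)                   ≡⟨ colourOf-inCopy c R i w ⟩
  colourOf c R w                              ≡⟨ lookup-copies c R w ⟨
  lookup (copies 1 c R) (toFin w)             ≡⟨ []=⇒lookup w∈ ⟩
  true                                        ∎)
  where open ≡-Reasoning

∣copies∣ : ∀ m {n} c (R : Subset n) → ∣ copies m c R ∣ ≡ m * (∣ c ∷ [] ∣ + ∣ R ∣)
∣copies∣ m c R = begin
  ∣ replicate m c ++ concat (replicate m R) ∣        ≡⟨ ∣p++q∣ (replicate m c) _ ⟩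
  ∣ replicate m c ∣ + ∣ concat (replicate m R) ∣    ≡⟨ cong₂ _+_ (∣replicate∣ m c) (∣concat-replicate∣ m R) ⟩
  m * ∣ c ∷ [] ∣ + m * ∣ R ∣                         ≡⟨ *-distribˡ-+ m _ _ ⟨
  m * (∣ c ∷ [] ∣ + ∣ R ∣)                           ∎
  where open ≡-Reasoning

∣copies∣≡*∣copy∣ : ∀ m {n} c (R : Subset n) → ∣ copies m c R ∣ ≡ m * ∣ copies 1 c R ∣
∣copies∣≡*∣copy∣ m c R = trans (∣copies∣ m c R) (cong (m *_) (trans (sym (*-identityˡ _)) (sym (∣copies∣ 1 c R))))

copies-complete : ∀ {n} (S : Subset (1 + 1 * n)) → ∃₂ λ c R → S ≡ copies 1 c R
copies-complete {n} (c ∷ rest) with group 1 n rest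
... | R ∷ [] , refl = c , R , refl

module _ (G H : Graph) where

  private
    m = order G
    n = order H

    toFinK : Vertex⊙ 1 n → Fin (order (K₁ ⊙ H))
    toFinK = toFin

    fromFinK : Fin (order (K₁ ⊙ H)) → Vertex⊙ 1 n
    fromFinK = fromFin

    toFinX : Vertex⊙ m n → Fin (order (G ⊙ H))
    toFinX = toFin

    fromFinX : Fin (order (G ⊙ H)) → Vertex⊙ m n
    fromFinX = fromFin

  copyOf : Fin m → Fin (order (K₁ ⊙ H)) → Fin (order (G ⊙ H))
  copyOf i u = toFinX (inCopy i (fromFinK u))

  copyOf-toFin : ∀ i w → copyOf i (toFinK w) ≡ toFinX (inCopy i w)
  copyOf-toFin i w = cong (toFinX ∘ inCopy i) (fromFin-toFin w)

  copyOf-adj : ∀ i u v → adj (G ⊙ H) (copyOf i u) (copyOf i v) ≡ adj (K₁ ⊙ H) u v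
  copyOf-adj i u v = begin
    adj (G ⊙ H) (copyOf i u) (copyOf i v)                    ≡⟨ adj-toFin G H (inCopy i (fromFinK u)) (inCopy i (fromFinK v)) ⟩
    adj⊙ G H (inCopy i (fromFinK u)) (inCopy i (fromFinK v)) ≡⟨ adj⊙-inCopy G H i (fromFinK u) (fromFinK v) ⟩
    adj⊙ K₁ H (fromFinK u) (fromFinK v)                       ≡⟨ adj-toFin K₁ H (fromFinK u) (fromFinK v) ⟨
    adj (K₁ ⊙ H) (toFinK (fromFinK u)) (toFinK (fromFinK v))  ≡⟨ cong₂ (adj (K₁ ⊙ H)) (toFin-fromFin {1} {n} u) (toFin-fromFin {1} {n} v) ⟩
    adj (K₁ ⊙ H) u v                                          ∎
    where open ≡-Reasoning

  centre : Fin (order (K₁ ⊙ H))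
  centre = toFinK (inj₁ zero)

  copyOf-nbr : ∀ i u y → adj (G ⊙ H) (copyOf i u) y ≡ true →
               (∃ λ w → y ≡ copyOf i w) ⊎ (u ≡ centre × ∃ λ j → y ≡ copyOf j centre)
  copyOf-nbr i u y u-y
    with adj⊙-inCopy-nbr G H i (fromFinK u) (fromFinX y) (trans (sym (adj-toFin-fromFin G H (inCopy i (fromFinK u)) y)) u-y)
  ... | inj₁ (w , y≡)      = inj₁ (toFinK w , trans (fromFin≡⇒≡toFin y≡) (sym (copyOf-toFin i w)))
  ... | inj₂ (u≡ , j , y≡) = inj₂ (fromFin≡⇒≡toFin {1} {n} u≡ , j , trans (fromFin≡⇒≡toFin y≡) (sym (copyOf-toFin j (inj₁ zero))))

  copies-zeroForcing : ∀ c R → IsZeroForcingSet (K₁ ⊙ H) (copies 1 c R) → IsZeroForcingSet (G ⊙ H) (copies m c R)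
  copies-zeroForcing c R zf y with inCopy-surjective G H (fromFinX y)
  ... | i , w , y≡ = subst (Black (G ⊙ H) (copies m c R)) (sym y≡copy) (zeroForcing⇒inAllCopies zf (toFinK w) i)
    where
    copyOf-∈ : ∀ i u → u ∈ copies 1 c R → copyOf i u ∈ copies m c R
    copyOf-∈ i u u∈ = ∈-copies-inCopy c R i (fromFinK u) (subst (_∈ copies 1 c R) (sym (toFin-fromFin {1} {n} u)) u∈)

    open CopyForcing (K₁ ⊙ H) (G ⊙ H) centre copyOf copyOf-adj copyOf-nbr (copies 1 c R) (copies m c R) copyOf-∈

    y≡copy : y ≡ copyOf i (toFinK w)
    y≡copy = trans (fromFin≡⇒≡toFin y≡) (sym (copyOf-toFin i w))

  zeroForcingNumber-⊙-≤ : ∀ {z z₁} → IsZeroForcingNumber (G ⊙ H) z → IsZeroForcingNumber (K₁ ⊙ H) z₁ → z ≤ m * z₁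
  zeroForcingNumber-⊙-≤ {z} (_ , minimal) ((S , zf , ∣S∣≡z₁) , _) with copies-complete S
  ... | c , R , refl = subst (z ≤_) (trans (∣copies∣≡*∣copy∣ m c R) (cong (m *_) ∣S∣≡z₁))
                             (minimal (copies m c R) (copies-zeroForcing c R zf))

order-⊙ : ∀ G H → order (G ⊙ H) ≡ order G * (order H + 1)
order-⊙ G H = begin
  m + m * n     ≡⟨ +-comm m (m * n) ⟩
  m * n + m     ≡⟨ cong (m * n +_) (*-identityʳ m) ⟨
  m * n + m * 1 ≡⟨ *-distribˡ-+ m n 1 ⟨
  m * (n + 1)   ∎
  where
  open ≡-Reasoning
  m = order G
  n = order H

order-⊙^ : ∀ G H k → order (G ⊙^ k [ H ]) ≡ order G * (order H + 1) ^ k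
order-⊙^ G H zero    = sym (*-identityʳ (order G))
order-⊙^ G H (suc k) = begin
  order ((G ⊙^ k [ H ]) ⊙ H)             ≡⟨ order-⊙ (G ⊙^ k [ H ]) H ⟩
  order (G ⊙^ k [ H ]) * (n + 1)         ≡⟨ cong (_* (n + 1)) (order-⊙^ G H k) ⟩
  order G * (n + 1) ^ k * (n + 1)        ≡⟨ *-assoc (order G) ((n + 1) ^ k) (n + 1) ⟩
  order G * ((n + 1) ^ k * (n + 1))      ≡⟨ cong (order G *_) (*-comm ((n + 1) ^ k) (n + 1)) ⟩
  order G * (n + 1) ^ suc k              ∎
  where
  open ≡-Reasoning
  n = order H

mainTheorem4 : (G H : Graph) → Connected G → 2 ≤ order G → 2 ≤ order H →
    (k : ℕ) → 1 ≤ k → (z z₁ : ℕ) →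
    IsZeroForcingNumber (G ⊙^ k [ H ]) z →
    IsZeroForcingNumber (K₁ ⊙ H) z₁ →
    z ≤ order G * (order H + 1) ^ (k Data.Nat.∸ 1) * z₁
mainTheorem4 G H _ _ _ zero    () z z₁ _ _
mainTheorem4 G H _ _ _ (suc k) _  z z₁ Z Z₁ =
  subst (z ≤_) (cong (_* z₁) (order-⊙^ G H k)) (zeroForcingNumber-⊙-≤ (G ⊙^ k [ H ]) H Z Z₁)
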